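{- Let $T$ and $T'$ be unrooted binary phylogenetic $X$-trees. Let $f_2$ be a two-state character with $|l_{f_2}(T)-l_{f_2}(T')|=d^2_{MP}(T,T')$, let $T^{*}\in\{T,T'\}$, and let $g_2$ be an optimal extension of $f_2$ to $T^{*}$ such that every connected component of the forest obtained from $T^{*}$ by deleting the mutation edges of $g_2$ contains at least two taxa. Let $f_c$ be the partition of $X$ whose blocks are the sets of taxa in the connected components of this forest. Then $f_c$ has a unique optimal extension to $T^{*}$, and this extension is the natural covering extension of $f_c$.
   Context: An unrooted binary phylogenetic $X$-tree: internal vertices of degree 3, leaves bijectively labelled by $X$. A character is a surjective $f:X\to\mathcal{C}$, identified with the partition of $X$ it induces. An extension $h:V(T)\to\mathcal{C}$ agrees with $f$ on $X$; $l_h(T)$ counts edges $\{u,v\}$ with $h(u)\neq h(v)$ (mutation edges); $l_f(T)=\min_h l_h(T)$; $h$ is optimal if $l_h(T)=l_f(T)$. $d^2_{MP}(T,T')=\max_f|l_f(T)-l_f(T')|$ over two-state characters. A character is convex on $T$ if the minimal subtrees spanning its blocks are pairwise vertex-disjoint. The natural partial extension of a convex character assigns to each vertex of the minimal subtree spanning a block the state of that block; when it assigns every vertex it is called the natural covering extension. -}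

module Defs where

open import Data.Nat using (ℕ; _+_; _≤_; ∣_-_∣)
open import Data.Fin using (Fin; _≟_)
open import Data.Product using (Σ; ∃; _×_; _,_; proj₁; proj₂)
open import Data.Sum using (_⊎_)
open import Data.List using (List; []; _∷_; length; filter)
open import Data.List.Relation.Unary.All using (All)
open import Data.List.Relation.Unary.Any using (Any)
open import Data.List.Relation.Unary.AllPairs using (AllPairs)
open import Data.List.Relation.Unary.Unique.Propositional using (Unique)
open import Data.List.Membership.Propositional using (_∈_)
open import Relation.Nullary using (¬_; ¬?)
open import Relation.Nullary.Decidable using (_⊎-dec_)
open import Relation.Binary.PropositionalEquality using (_≡_; _≢_)

-- Graphs on vertex set Fin m, given by a list of (undirected) edges.

Edge : ℕ → Set
Edge m = Fin m × Fin m

SameEdge : ∀ {m} → Edge m → Edge m → Set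
SameEdge (u , v) (u' , v') = (u ≡ u' × v ≡ v') ⊎ (u ≡ v' × v ≡ u')

Adj : ∀ {m} → List (Edge m) → Fin m → Fin m → Set
Adj E u v = Any (λ e → SameEdge e (u , v)) E

data Reach {m} (E : List (Edge m)) : Fin m → Fin m → Set where
  here : ∀ {u} → Reach E u u
  step : ∀ {u w v} → Adj E u w → Reach E w v → Reach E u v

data Walk {m} (E : List (Edge m)) : Fin m → Fin m → List (Fin m) → Set where
  single : ∀ {v} → Walk E v v (v ∷ [])
  cons   : ∀ {u w v p} → Adj E u w → Walk E w v p → Walk E u v (u ∷ p)

IsPath : ∀ {m} → List (Edge m) → Fin m → Fin m → List (Fin m) → Set
IsPath E a b p = Walk E a b p × Unique p

deg : ∀ {m} → List (Edge m) → Fin m → ℕ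
deg E v = length (filter (λ e → (proj₁ e ≟ v) ⊎-dec (proj₂ e ≟ v)) E)

record PhyloTree (n : ℕ) : Set where
  field
    m        : ℕ
    edges    : List (Edge m)
    leaf     : Fin n → Fin m
    noLoops  : All (λ e → proj₁ e ≢ proj₂ e) edges
    noMulti  : AllPairs (λ e e' → ¬ SameEdge e e') edges
    -- a tree: connected with |E| = |V| - 1
    connected : ∀ u v → Reach edges u v
    edgeCount : length edges + 1 ≡ m
    leafInj    : ∀ x y → leaf x ≡ leaf y → x ≡ y
    leafIsLeaf : ∀ x → deg edges (leaf x) ≤ 1
    leavesLabelled : ∀ v → deg edges v ≤ 1 → ∃ λ x → leaf x ≡ v
    internalDeg : ∀ v → (∀ x → leaf x ≢ v) → deg edges v ≡ 3

open PhyloTree public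

Surjective : ∀ {n k} → (Fin n → Fin k) → Set
Surjective {n} {k} f = ∀ (c : Fin k) → ∃ λ (x : Fin n) → f x ≡ c

Character : ℕ → ℕ → Set
Character n k = Σ (Fin n → Fin k) Surjective

module _ {n : ℕ} (T : PhyloTree n) where

  IsExtension : ∀ {k} → (Fin n → Fin k) → (Fin (m T) → Fin k) → Set
  IsExtension f h = ∀ x → h (leaf T x) ≡ f x

  mutationEdges : ∀ {k} → (Fin (m T) → Fin k) → List (Edge (m T))
  mutationEdges h = filter (λ e → ¬? (h (proj₁ e) ≟ h (proj₂ e))) (edges T)

  changes : ∀ {k} → (Fin (m T) → Fin k) → ℕ
  changes h = length (mutationEdges h)

  forestEdges : ∀ {k} → (Fin (m T) → Fin k) → List (Edge (m T))
  forestEdges h = filter (λ e → h (proj₁ e) ≟ h (proj₂ e)) (edges T)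

  IsParsimonyScore : ∀ {k} → (Fin n → Fin k) → ℕ → Set
  IsParsimonyScore f s =
    (∃ λ h → IsExtension f h × changes h ≡ s) ×
    (∀ h → IsExtension f h → s ≤ changes h)

  IsOptimal : ∀ {k} → (Fin n → Fin k) → (Fin (m T) → Fin k) → Set
  IsOptimal f h = IsExtension f h × (∀ h' → IsExtension f h' → changes h ≤ changes h')

  -- v lies in the minimal subtree of T spanning the block of state c of f
  InSpanningSubtree : ∀ {k} → (Fin n → Fin k) → Fin k → Fin (m T) → Set
  InSpanningSubtree f c v =
    ∃ λ x → ∃ λ y → f x ≡ c × f y ≡ c ×
      ∃ λ p → IsPath (edges T) (leaf T x) (leaf T y) p × v ∈ p

  -- h is the natural covering extension of the (convex) character f:
  -- the natural partial extension assigns every vertex, and h equals it.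
  IsNaturalCoveringExtension : ∀ {k} → (Fin n → Fin k) → (Fin (m T) → Fin k) → Set
  IsNaturalCoveringExtension f h =
    (∀ v → ∃ λ c → InSpanningSubtree f c v) ×
    (∀ v c → InSpanningSubtree f c v → h v ≡ c)

-- d²_MP(T,T') = |l_f(T) - l_f(T')| for the two-state character f
AttainsD2MP : ∀ {n} → PhyloTree n → PhyloTree n → Character n 2 → Set
AttainsD2MP {n} T T' (f , _) =
  ∀ (g : Character n 2) a b a' b' →
    IsParsimonyScore T f a → IsParsimonyScore T' f b →
    IsParsimonyScore T (proj₁ g) a' → IsParsimonyScore T' (proj₁ g) b' →
    ∣ a' - b' ∣ ≤ ∣ a - b ∣

-- Deleting the mutation edges of g₂ leaves a forest with l(g₂) + 1 components, so f_c has at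
-- least l(g₂) + 1 blocks, and colouring every component by its block is an extension of f_c
-- whose mutation edges are mutation edges of g₂. Every extension h of f_c induces, by sending each
-- block to its f₂-state, an extension of f₂ with at most l_h(T*) changes; hence the component
-- colouring is optimal and every optimal h has fewer changes than f_c has blocks. Such an h cannot
-- split a block, because one taxon from each block plus a second taxon of the split block would lie
-- in distinct components of its forest; and as monochromatic components in a tree are subtrees,
-- h is constant on every spanning subtree. Finally, optimality of g₂ forces every internal vertex
-- to have two incident non-mutation edges (otherwise recolouring it would save a change), so every
-- vertex lies on a forest path between two taxa, i.e. in some spanning subtree.

module Submission where

open import Defs
open import Data.Nat using (ℕ; zero; suc; _+_; _≤_; _<_; z≤n; s≤s)
open import Data.Nat.Properties using (≤-refl; ≤-trans; ≤-reflexive; ≤-antisym; ≤-pred; ≤-<-trans; _≤?_; ≰⇒>; n≮n; m≤n⇒m≤1+n; m<m+n; +-suc; +-comm; +-monoʳ-≤; +-mono-≤; +-cancelˡ-≤; +-cancelʳ-≤; module ≤-Reasoning)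
open import Data.Fin using (Fin; zero; suc; _≟_)
open import Data.Fin.Properties using (pigeonhole; any?)
open import Data.Product using (Σ; ∃; _×_; _,_; proj₁; proj₂)
open import Data.Sum using (_⊎_; inj₁; inj₂)
open import Data.Empty using (⊥-elim)
open import Data.List using (List; []; _∷_; length; filter; _++_; lookup; reverse; tabulate; allFin)
open import Data.List.Properties using (length-map; length-tabulate; length-removeAt′; ++-identityʳ; ++-assoc; unfold-reverse; reverse-++)
open import Data.List.Relation.Unary.All as All using (All; []; _∷_)
open import Data.List.Relation.Unary.All.Properties using (anti-mono; tabulate⁺; ¬Any⇒All¬)
open import Data.List.Relation.Unary.Any as Any using (Any; here; there; _─_)
open import Data.List.Relation.Unary.Any.Properties using (reverse⁻; ++⁺ˡ; ++⁺ʳ)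
open import Data.List.Relation.Unary.AllPairs as AllPairs using (AllPairs; []; _∷_)
import Data.List.Relation.Unary.AllPairs.Properties as AllPairs
open import Data.List.Relation.Unary.Unique.Propositional using (Unique)
open import Data.List.Relation.Unary.Unique.Propositional.Properties using (++⁺; allFin⁺)
open import Data.List.Membership.Propositional using (_∈_; _∉_; find; lose)
open import Data.List.Membership.Propositional.Properties using (∈-lookup; ∈-filter⁺; ∈-filter⁻; ∈-++⁺ʳ)
open import Data.List.Relation.Binary.Subset.Propositional using (_⊆_)
open import Function using (_∘_)
open import Function.Bundles using (_⇔_; mk⇔; Equivalence)
open import Relation.Nullary using (¬_; Dec; yes; no)
open import Relation.Nullary.Decidable using (_⊎-dec_; _×-dec_; map′)
open import Relation.Unary using (Decidable)
open import Relation.Unary.Properties using (_∩?_; ∁?)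
open import Relation.Binary.PropositionalEquality using (_≡_; _≢_; refl; sym; trans; cong; cong₂; subst; subst₂)

unique-lookup : ∀ {A : Set} {xs : List A} → Unique xs → ∀ {i j : Fin (length xs)} →
                i Data.Fin.< j → lookup xs i ≢ lookup xs j
unique-lookup (x∉ ∷ _) {zero} {suc j} _ eq = All.lookup x∉ (∈-lookup j) eq
unique-lookup (_ ∷ u) {suc i} {suc j} (s≤s i<j) eq = unique-lookup u i<j eq

length-unique-Fin : ∀ {k} {xs : List (Fin k)} → Unique xs → length xs ≤ k
length-unique-Fin {k} {xs} u with length xs ≤? k
... | yes le = le
... | no nle with pigeonhole (≰⇒> nle) (lookup xs)
...   | i , j , i<j , eq = ⊥-elim (unique-lookup u i<j eq)

unique-reverse : ∀ {A : Set} {xs : List A} → Unique xs → Unique (reverse xs)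
unique-reverse {xs = []} u = u
unique-reverse {xs = x ∷ xs} (x∉ ∷ u) = subst Unique (sym (unfold-reverse x xs))
  (++⁺ (unique-reverse u) ([] ∷ []) λ { (y∈ , here refl) → All.lookup x∉ (reverse⁻ y∈) refl })

any-─ : ∀ {A : Set} {P Q : A → Set} {xs} (i : Any P xs) → Any Q xs →
        (∃ λ x → P x × Q x) ⊎ Any Q (xs ─ i)
any-─ (here p) (here q) = inj₁ (_ , p , q)
any-─ (here p) (there j) = inj₂ j
any-─ (there i) (here q) = inj₂ (here q)
any-─ (there i) (there j) with any-─ i j
... | inj₁ r = inj₁ r
... | inj₂ r = inj₂ (there r)

module _ {A : Set} where

  length-filter-mono : ∀ {P Q : A → Set} (P? : Decidable P) (Q? : Decidable Q) xs →
                       (∀ {x} → x ∈ xs → P x → Q x) → length (filter P? xs) ≤ length (filter Q? xs)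
  length-filter-mono P? Q? [] _ = z≤n
  length-filter-mono P? Q? (x ∷ xs) P⇒Q with P? x | Q? x
  ... | yes _ | yes _ = s≤s (length-filter-mono P? Q? xs (λ x∈ → P⇒Q (there x∈)))
  ... | yes p | no ¬q = ⊥-elim (¬q (P⇒Q (here refl) p))
  ... | no _ | yes _ = m≤n⇒m≤1+n (length-filter-mono P? Q? xs (λ x∈ → P⇒Q (there x∈)))
  ... | no _ | no _ = length-filter-mono P? Q? xs (λ x∈ → P⇒Q (there x∈))

  length-filter-cong : ∀ {P Q : A → Set} (P? : Decidable P) (Q? : Decidable Q) xs →
                       (∀ {x} → x ∈ xs → P x → Q x) → (∀ {x} → x ∈ xs → Q x → P x) →
                       length (filter P? xs) ≡ length (filter Q? xs)
  length-filter-cong P? Q? xs P⇒Q Q⇒P =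
    ≤-antisym (length-filter-mono P? Q? xs P⇒Q) (length-filter-mono Q? P? xs Q⇒P)

  length-filter-∁ : ∀ {P : A → Set} (P? : Decidable P) xs →
                    length (filter P? xs) + length (filter (∁? P?) xs) ≡ length xs
  length-filter-∁ P? [] = refl
  length-filter-∁ P? (x ∷ xs) with P? x
  ... | yes _ = cong suc (length-filter-∁ P? xs)
  ... | no _ = trans (+-suc _ _) (cong suc (length-filter-∁ P? xs))

  length-filter-split : ∀ {P Q : A → Set} (P? : Decidable P) (Q? : Decidable Q) xs →
                        length (filter P? xs) ≡ length (filter (P? ∩? Q?) xs) + length (filter (P? ∩? ∁? Q?) xs)
  length-filter-split P? Q? [] = refl
  length-filter-split P? Q? (x ∷ xs) with P? x | Q? x
  ... | yes _ | yes _ = cong suc (length-filter-split P? Q? xs)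
  ... | yes _ | no _ = trans (cong suc (length-filter-split P? Q? xs)) (sym (+-suc _ _))
  ... | no _ | yes _ = length-filter-split P? Q? xs
  ... | no _ | no _ = length-filter-split P? Q? xs

  filter-witness : ∀ {P : A → Set} (P? : Decidable P) xs → 1 ≤ length (filter P? xs) →
                   ∃ λ x → x ∈ xs × P x
  filter-witness P? (x ∷ xs) one with P? x
  ... | yes px = x , here refl , px
  ... | no _ with filter-witness P? xs one
  ...   | y , y∈ , py = y , there y∈ , py

  filter-pair : ∀ {P : A → Set} {R : A → A → Set} (P? : Decidable P) {xs} → AllPairs R xs →
                2 ≤ length (filter P? xs) → ∃ λ x → ∃ λ y → x ∈ xs × y ∈ xs × P x × P y × R x y
  filter-pair P? {x ∷ xs} (Rx ∷ Rxs) two with P? x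
  ... | yes px with filter-witness P? xs (≤-pred two)
  ...   | y , y∈ , py = x , y , here refl , there y∈ , px , py , All.lookup Rx y∈
  filter-pair P? {x ∷ xs} (_ ∷ Rxs) two | no _ with filter-pair P? Rxs two
  ...   | y , z , y∈ , z∈ , py , pz , Ryz = y , z , there y∈ , there z∈ , py , pz , Ryz

module _ {m : ℕ} where

  sameEdge-flip : ∀ {u v : Fin m} → SameEdge (u , v) (v , u)
  sameEdge-flip = inj₂ (refl , refl)

  sameEdge-sym : ∀ {e e' : Edge m} → SameEdge e e' → SameEdge e' e
  sameEdge-sym (inj₁ (refl , refl)) = inj₁ (refl , refl)
  sameEdge-sym (inj₂ (refl , refl)) = inj₂ (refl , refl)

  sameEdge-trans : ∀ {e e' e'' : Edge m} → SameEdge e e' → SameEdge e' e'' → SameEdge e e''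
  sameEdge-trans (inj₁ (refl , refl)) s = s
  sameEdge-trans (inj₂ (refl , refl)) (inj₁ (refl , refl)) = inj₂ (refl , refl)
  sameEdge-trans (inj₂ (refl , refl)) (inj₂ (refl , refl)) = inj₁ (refl , refl)

  adj-sym : ∀ {E : List (Edge m)} {u v} → Adj E u v → Adj E v u
  adj-sym = Any.map (λ s → sameEdge-trans s sameEdge-flip)

  reach-trans : ∀ {E : List (Edge m)} {a b c} → Reach E a b → Reach E b c → Reach E a c
  reach-trans here r = r
  reach-trans (step x r) r' = step x (reach-trans r r')

  adj⇒reach : ∀ {E : List (Edge m)} {a b} → Adj E a b → Reach E a b
  adj⇒reach x = step x here

  reach-sym : ∀ {E : List (Edge m)} {a b} → Reach E a b → Reach E b a
  reach-sym here = here
  reach-sym (step x r) = reach-trans (reach-sym r) (adj⇒reach (adj-sym x))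

  reach-mono : ∀ {E E' : List (Edge m)} → (∀ {a b} → Adj E a b → Reach E' a b) →
               ∀ {a b} → Reach E a b → Reach E' a b
  reach-mono f here = here
  reach-mono f (step x r) = reach-trans (f x) (reach-mono f r)

  reach-[] : ∀ {a b : Fin m} → Reach [] a b → a ≡ b
  reach-[] here = refl

  walk⇒reach : ∀ {E : List (Edge m)} {a b p} → Walk E a b p → Reach E a b
  walk⇒reach single = here
  walk⇒reach (cons x w) = step x (walk⇒reach w)

  walk-mono : ∀ {E E' : List (Edge m)} → (∀ {a b} → Adj E a b → Adj E' a b) →
              ∀ {a b p} → Walk E a b p → Walk E' a b p
  walk-mono f single = single
  walk-mono f (cons x w) = cons (f x) (walk-mono f w)

  ReachVia : List (Edge m) → Edge m → Fin m → Fin m → Set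
  ReachVia E (p , q) a b = Reach E a b ⊎ ((Reach E a p ⊎ Reach E a q) × (Reach E p b ⊎ Reach E q b))

  reach-∷⁻ : ∀ {E : List (Edge m)} {e a b} → Reach (e ∷ E) a b → ReachVia E e a b
  reach-∷⁻ here = inj₁ here
  reach-∷⁻ (step (here s) r) with reach-∷⁻ r | s
  ... | inj₁ r' | inj₁ (refl , refl) = inj₂ (inj₁ here , inj₂ r')
  ... | inj₂ (_ , r') | inj₁ (refl , refl) = inj₂ (inj₁ here , r')
  ... | inj₁ r' | inj₂ (refl , refl) = inj₂ (inj₂ here , inj₁ r')
  ... | inj₂ (_ , r') | inj₂ (refl , refl) = inj₂ (inj₂ here , r')
  reach-∷⁻ (step (there x) r) with reach-∷⁻ r
  ... | inj₁ r' = inj₁ (step x r')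
  ... | inj₂ (inj₁ ap , r') = inj₂ (inj₁ (step x ap) , r')
  ... | inj₂ (inj₂ aq , r') = inj₂ (inj₂ (step x aq) , r')

  reach-∷⁺ : ∀ {E : List (Edge m)} {e a b} → ReachVia E e a b → Reach (e ∷ E) a b
  reach-∷⁺ {E} {p , q} = λ where
      (inj₁ r) → weaken r
      (inj₂ (inj₁ ap , inj₁ pb)) → reach-trans (weaken ap) (weaken pb)
      (inj₂ (inj₁ ap , inj₂ qb)) → reach-trans (weaken ap) (step (here (inj₁ (refl , refl))) (weaken qb))
      (inj₂ (inj₂ aq , inj₁ pb)) → reach-trans (weaken aq) (step (here sameEdge-flip) (weaken pb))
      (inj₂ (inj₂ aq , inj₂ qb)) → reach-trans (weaken aq) (weaken qb)
    where
      weaken : ∀ {a b} → Reach E a b → Reach ((p , q) ∷ E) a b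
      weaken = reach-mono (λ x → adj⇒reach (there x))

  reach? : (E : List (Edge m)) → ∀ a b → Dec (Reach E a b)
  reach? [] a b = map′ (λ { refl → here }) reach-[] (a ≟ b)
  reach? ((p , q) ∷ E) a b = map′ reach-∷⁺ reach-∷⁻
    (reach? E a b ⊎-dec ((reach? E a p ⊎-dec reach? E a q) ×-dec (reach? E p b ⊎-dec reach? E q b)))

module _ {m : ℕ} {E : List (Edge m)} where

  walk-∷ʳ : ∀ {a b c p} → Walk E a b p → Adj E b c → Walk E a c (p ++ c ∷ [])
  walk-∷ʳ single x = cons x single
  walk-∷ʳ (cons y w) x = cons y (walk-∷ʳ w x)

  walk-reverse : ∀ {a b p} → Walk E a b p → Walk E b a (reverse p)
  walk-reverse single = single
  walk-reverse {p = a ∷ p} (cons x w) =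
    subst (Walk E _ _) (sym (unfold-reverse a p)) (walk-∷ʳ (walk-reverse w) (adj-sym x))

  walk-prefix : ∀ {a b q z} → Walk E a b q → z ∈ q → ∃ λ q' → Walk E a z q' × q' ⊆ q
  walk-prefix single (here refl) = _ , single , λ z∈ → z∈
  walk-prefix (cons x w) (here refl) = _ , single , λ { (here refl) → here refl }
  walk-prefix (cons x w) (there z∈) with walk-prefix w z∈
  ... | q' , w' , q'⊆q = _ , cons x w' , λ { (here refl) → here refl ; (there y∈) → there (q'⊆q y∈) }

-- Counting components

module _ {m : ℕ} where

  Separated : List (Edge m) → List (Fin m) → Set
  Separated E = AllPairs (λ a b → ¬ Reach E a b)

  unreach-∷ : ∀ {E : List (Edge m)} {p q a b} →
              ¬ Reach E a b → ¬ Reach E a p → ¬ Reach E b p → ¬ Reach ((p , q) ∷ E) a b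
  unreach-∷ nab nap nbp r with reach-∷⁻ r
  ... | inj₁ ab = nab ab
  ... | inj₂ (inj₁ ap , _) = nap ap
  ... | inj₂ (inj₂ aq , inj₁ pb) = nbp (reach-sym pb)
  ... | inj₂ (inj₂ aq , inj₂ qb) = nab (reach-trans aq qb)

  separated-∷ : ∀ {E : List (Edge m)} {p q L} →
                All (λ b → ¬ Reach E b p) L → Separated E L → Separated ((p , q) ∷ E) L
  separated-∷ [] [] = []
  separated-∷ (nap ∷ nLp) (naL ∷ sL) =
    All.zipWith (λ (nab , nbp) → unreach-∷ nab nap nbp) (naL , nLp) ∷ separated-∷ nLp sL

  -- At most one vertex of a separated list lies in the component of p.
  dropComponent : ∀ {E : List (Edge m)} p {L} → Separated E L →
                  ∃ λ L' → L' ⊆ L × Separated E L' × All (λ b → ¬ Reach E b p) L' ×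
                    length L ≤ suc (length L')
  dropComponent p [] = [] , (λ ()) , [] , [] , z≤n
  dropComponent {E} p {a ∷ L} (naL ∷ sL) with reach? E a p
  ... | yes ap = L , there , sL , All.map (λ nab bp → nab (reach-trans ap (reach-sym bp))) naL , ≤-refl
  ... | no nap with dropComponent p sL
  ...   | L' , L'⊆L , sL' , nL'p , le =
          a ∷ L' , (λ { (here refl) → here refl ; (there z∈) → there (L'⊆L z∈) }) ,
          anti-mono L'⊆L naL ∷ sL' , nap ∷ nL'p , s≤s le

  separated-++ : ∀ (M : List (Edge m)) {E L} → Separated E L →
                 ∃ λ L' → Separated (M ++ E) L' × length L ≤ length M + length L'
  separated-++ [] {L = L} sL = L , sL , ≤-refl
  separated-++ ((p , q) ∷ M) sL with separated-++ M sL
  ... | L₁ , sL₁ , le₁ with dropComponent p sL₁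
  ...   | L₂ , _ , sL₂ , nL₂p , le₂ =
          L₂ , separated-∷ nL₂p sL₂ ,
          ≤-trans le₁ (≤-trans (+-monoʳ-≤ (length M) le₂) (≤-reflexive (+-suc (length M) (length L₂))))

  separated-connected : ∀ {E : List (Edge m)} {L} → (∀ a b → Reach E a b) → Separated E L → length L ≤ 1
  separated-connected conn [] = z≤n
  separated-connected conn (_ ∷ []) = s≤s z≤n
  separated-connected {L = a ∷ b ∷ _} conn ((nab ∷ _) ∷ _) = ⊥-elim (nab (conn a b))

  length-separated : ∀ (M : List (Edge m)) {E L} → (∀ a b → Reach (M ++ E) a b) →
                     Separated E L → length L ≤ length M + 1
  length-separated M conn sL with separated-++ M sL
  ... | L' , sL' , le = ≤-trans le (+-monoʳ-≤ (length M) (separated-connected conn sL'))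

  separated-allFin : Separated [] (allFin m)
  separated-allFin = AllPairs.map (λ a≢b r → a≢b (reach-[] r)) (allFin⁺ m)

  separatedRepresentatives : ∀ (E : List (Edge m)) →
                             ∃ λ L → Separated E L × m ≤ length E + length L
  separatedRepresentatives E with separated-++ E separated-allFin
  ... | L , sL , le =
        L , subst (λ E' → Separated E' L) (++-identityʳ E) sL ,
        subst (_≤ length E + length L) (length-tabulate (λ i → i)) le

  connected⇒vertices≤edges+1 : ∀ {E : List (Edge m)} → (∀ a b → Reach E a b) → m ≤ length E + 1
  connected⇒vertices≤edges+1 {E} conn =
    subst (_≤ length E + 1) (length-tabulate (λ i → i))
      (length-separated E (λ a b → subst (λ E' → Reach E' a b) (sym (++-identityʳ E)) (conn a b))
        separated-allFin)

module _ {m j : ℕ} (h : Fin m → Fin j) where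

  Monochromatic : Edge m → Set
  Monochromatic e = h (proj₁ e) ≡ h (proj₂ e)

  monochromatic? : ∀ e → Dec (Monochromatic e)
  monochromatic? e = h (proj₁ e) ≟ h (proj₂ e)

  monochromaticEdges : List (Edge m) → List (Edge m)
  monochromaticEdges = filter monochromatic?

  adj-monochromatic⁻ : ∀ {E a b} → Adj (monochromaticEdges E) a b → Adj E a b × h a ≡ h b
  adj-monochromatic⁻ {E} x with find x
  ... | (p , q) , e∈ , s with ∈-filter⁻ monochromatic? {xs = E} e∈
  ...   | e∈E , hp≡hq = lose e∈E s , colour s hp≡hq
    where
      colour : ∀ {a b} → SameEdge (p , q) (a , b) → h p ≡ h q → h a ≡ h b
      colour (inj₁ (refl , refl)) eq = eq
      colour (inj₂ (refl , refl)) eq = sym eq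

  adj-monochromatic⁺ : ∀ {E a b} → Adj E a b → h a ≡ h b → Adj (monochromaticEdges E) a b
  adj-monochromatic⁺ {E} x ha≡hb with find x
  ... | (p , q) , e∈ , s = lose (∈-filter⁺ monochromatic? e∈ (colour s)) s
    where
      colour : SameEdge (p , q) _ → h p ≡ h q
      colour (inj₁ (refl , refl)) = ha≡hb
      colour (inj₂ (refl , refl)) = sym ha≡hb

  reach-monochromatic⇒≡ : ∀ {E a b} → Reach (monochromaticEdges E) a b → h a ≡ h b
  reach-monochromatic⇒≡ here = refl
  reach-monochromatic⇒≡ {E} (step x r) =
    trans (proj₂ (adj-monochromatic⁻ {E} x)) (reach-monochromatic⇒≡ {E} r)

-- Trees

module Tree {m : ℕ} (E : List (Edge m)) (conn : ∀ u v → Reach E u v) (size : length E + 1 ≡ m) where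

  -- Otherwise E ─ ix would be a connected graph on m vertices with only m - 2 edges.
  bridge : ∀ {u v} (ix : Adj E u v) → ¬ Reach (E ─ ix) u v
  bridge {u} {v} ix uv = n≮n m (≤-trans (s≤s m≤|E|) (≤-reflexive (trans (+-comm 1 (length E)) size)))
    where
      reroute : ∀ {a b} → Adj E a b → Reach (E ─ ix) a b
      reroute x with any-─ ix x
      ... | inj₂ x' = adj⇒reach x'
      ... | inj₁ (_ , s₁ , s₂) with sameEdge-trans (sameEdge-sym s₁) s₂
      ...   | inj₁ (refl , refl) = uv
      ...   | inj₂ (refl , refl) = reach-sym uv
      m≤|E| : m ≤ length E
      m≤|E| = subst (m ≤_) (trans (+-comm (length (E ─ ix)) 1) (sym (length-removeAt′ E (Any.index ix))))
                (connected⇒vertices≤edges+1 (λ a b → reach-mono reroute (conn a b)))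

  adj-irrefl : ∀ {u v} → Adj E u v → u ≢ v
  adj-irrefl ix refl = bridge ix here

  walk-crosses-bridge : ∀ {u v} (ix : Adj E u v) {a b q} → Walk E a b q → ¬ Reach (E ─ ix) a b → u ∈ q
  walk-crosses-bridge ix single nab = ⊥-elim (nab here)
  walk-crosses-bridge ix (cons x w) nab with any-─ ix x
  ... | inj₂ x' = there (walk-crosses-bridge ix w (λ r → nab (step x' r)))
  ... | inj₁ (_ , s₁ , s₂) with sameEdge-trans (sameEdge-sym s₁) s₂
  ...   | inj₁ (refl , refl) = here refl
  ...   | inj₂ (refl , refl) = there (walk-head w)
    where
      walk-head : ∀ {a b p} → Walk E a b p → a ∈ p
      walk-head single = here refl
      walk-head (cons _ _) = here refl

  -- An edge of the path changing colour would be a bridge avoided by the monochromatic connection s ⇝ t.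
  path-monochromatic : ∀ {j} (h : Fin m → Fin j) {s t p} → Walk E s t p → Unique p →
                       Reach (monochromaticEdges h E) s t → ∀ {z} → z ∈ p → Reach (monochromaticEdges h E) s z
  path-monochromatic h single _ _ (here refl) = here
  path-monochromatic h (cons x w) _ _ (here refl) = here
  path-monochromatic h {s} {t} (cons {w = s'} x w) (s∉ ∷ u) st (there z∈) with h s ≟ h s'
  ... | yes hs≡hs' =
        let ss' = adj-monochromatic⁺ h x hs≡hs'
        in step ss' (path-monochromatic h w u (reach-trans (reach-sym (adj⇒reach ss')) st) z∈)
  ... | no hs≢hs' = ⊥-elim (All.lookup s∉ (walk-crosses-bridge x w s't-cut) refl)
    where
      avoid : ∀ {a b} → Adj (monochromaticEdges h E) a b → Reach (E ─ x) a b
      avoid y with adj-monochromatic⁻ h {E} y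
      ... | y' , ha≡hb with any-─ x y'
      ...   | inj₂ y'' = adj⇒reach y''
      ...   | inj₁ (_ , s₁ , s₂) with sameEdge-trans (sameEdge-sym s₁) s₂
      ...     | inj₁ (refl , refl) = ⊥-elim (hs≢hs' ha≡hb)
      ...     | inj₂ (refl , refl) = ⊥-elim (hs≢hs' (sym ha≡hb))
      s't-cut : ¬ Reach (E ─ x) s' t
      s't-cut s't = bridge x (reach-trans (reach-mono avoid st) (reach-sym s't))

  module Leaves (F : List (Edge m)) (F⊆E : ∀ {a b} → Adj F a b → Adj E a b)
    {Marked : Fin m → Set} (marked? : ∀ v → Dec (Marked v))
    (branching : ∀ v → ¬ Marked v → ∃ λ w₁ → ∃ λ w₂ → w₁ ≢ w₂ × Adj F v w₁ × Adj F v w₂)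
    where

    adj-─ : ∀ {u v w} (ix : Adj E u w) → Adj E u v → v ≢ w → Adj (E ─ ix) u v
    adj-─ ix x v≢w with any-─ ix x
    ... | inj₂ x' = x'
    ... | inj₁ (_ , s₁ , s₂) with sameEdge-trans (sameEdge-sym s₁) s₂
    ...   | inj₁ (_ , refl) = ⊥-elim (v≢w refl)
    ...   | inj₂ (refl , refl) = ⊥-elim (adj-irrefl ix refl)

    -- In a tree a walk can only return to a vertex by backtracking.
    fresh : ∀ {cur prev rest end w} → Adj F cur prev → Walk F prev end (prev ∷ rest) →
            Unique (cur ∷ prev ∷ rest) → Adj F cur w → w ≢ prev → w ∉ cur ∷ prev ∷ rest
    fresh _ _ _ cw _ (here refl) = adj-irrefl (F⊆E cw) refl
    fresh _ _ _ _ w≢prev (there (here w≡prev)) = w≢prev w≡prev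
    fresh {cur} cp wt (cur∉ ∷ _) cw w≢prev (there (there w∈rest)) with walk-prefix wt (there w∈rest)
    ... | q , pw , q⊆ = All.lookup cur∉ (q⊆ (walk-crosses-bridge ix (walk-mono F⊆E pw) separated)) refl
      where
        ix = F⊆E cw
        separated : ¬ Reach (E ─ ix) _ _
        separated prev⇝w = bridge ix (step (adj-─ ix (F⊆E cp) (λ prev≡w → w≢prev (sym prev≡w))) prev⇝w)

    turn : ∀ v u → ¬ Marked v → ∃ λ w → Adj F v w × w ≢ u
    turn v u ¬mv with branching v ¬mv
    ... | w₁ , w₂ , w₁≢w₂ , x₁ , x₂ with w₁ ≟ u
    ...   | yes refl = w₂ , x₂ , λ w₂≡w₁ → w₁≢w₂ (sym w₂≡w₁)
    ...   | no w₁≢u = w₁ , x₁ , w₁≢u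

    FromMarked : Fin m → List (Fin m) → Set
    FromMarked end P = ∃ λ a → Marked a × ∃ λ ext → Walk F a end (ext ++ P) × Unique (ext ++ P)

    walk-uncons : ∀ {a b c p} → Walk F a b (a ∷ c ∷ p) → Adj F a c × Walk F c b (c ∷ p)
    walk-uncons (cons x single) = x , single
    walk-uncons (cons x (cons y w)) = x , cons y w

    -- By fresh the walk stays a path while it grows, so fuel m suffices to reach a marked vertex.
    extend : ∀ (fuel : ℕ) {cur prev rest end} → Walk F cur end (cur ∷ prev ∷ rest) →
             Unique (cur ∷ prev ∷ rest) → m < fuel + length (cur ∷ prev ∷ rest) →
             FromMarked end (cur ∷ prev ∷ rest)
    extend fuel {cur} wc u bound with marked? cur
    ... | yes mc = cur , mc , [] , wc , u
    extend zero _ u bound | no _ = ⊥-elim (n≮n _ (≤-trans bound (length-unique-Fin u)))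
    extend (suc fuel) {cur} {prev} {rest} wc u bound | no ¬mc with turn cur prev ¬mc | walk-uncons wc
    ... | w , cw , w≢prev | cp , wt
          with extend fuel (cons (adj-sym cw) wc) (¬Any⇒All¬ _ (fresh cp wt u cw w≢prev) ∷ u)
                 (≤-trans bound (≤-reflexive (sym (+-suc fuel (length (cur ∷ prev ∷ rest))))))
    ...   | a , ma , ext , wa , ua =
            a , ma , ext ++ w ∷ [] , subst (Walk F a _) eq wa , subst Unique eq ua
      where
        eq = sym (++-assoc ext (w ∷ []) (cur ∷ prev ∷ rest))

    unique-branch : ∀ {v w₁ w₂} → w₁ ≢ w₂ → Adj F v w₁ → Adj F v w₂ →
                    Unique (w₂ ∷ v ∷ w₁ ∷ [])
    unique-branch w₁≢w₂ x₁ x₂ =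
      ((λ w₂≡v → adj-irrefl (F⊆E x₂) (sym w₂≡v)) ∷ (λ w₂≡w₁ → w₁≢w₂ (sym w₂≡w₁)) ∷ [])
      ∷ (adj-irrefl (F⊆E x₁) ∷ []) ∷ [] ∷ []

    -- Extend the walk w₂ v w₁ at w₂ to a marked vertex, reverse it, and extend it at w₁.
    pathThrough : ∀ {v w₁ w₂} → w₁ ≢ w₂ → Adj F v w₁ → Adj F v w₂ →
                  ∃ λ a → ∃ λ b → Marked a × Marked b × ∃ λ p → IsPath F a b p × v ∈ p
    pathThrough {v} {w₁} {w₂} w₁≢w₂ x₁ x₂
      with extend m (cons (adj-sym x₂) (cons x₁ single)) (unique-branch w₁≢w₂ x₁ x₂)
                  (m<m+n m (s≤s z≤n))
    ... | b , mb , ext₂ , wb , ub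
          with extend m (subst (Walk F w₁ b) (reverse-++ ext₂ (w₂ ∷ v ∷ w₁ ∷ [])) (walk-reverse wb))
                 (subst Unique (reverse-++ ext₂ (w₂ ∷ v ∷ w₁ ∷ [])) (unique-reverse ub))
                 (m<m+n m (s≤s z≤n))
    ...   | a , ma , ext₁ , wa , ua = a , b , ma , mb , _ , (wa , ua) , ∈-++⁺ʳ ext₁ (there (here refl))

    onMarkedPath : ∀ v → ∃ λ a → ∃ λ b → Marked a × Marked b × ∃ λ p → IsPath F a b p × v ∈ p
    onMarkedPath v with marked? v
    ... | yes mv = v , v , mv , mv , v ∷ [] , (single , [] ∷ []) , here refl
    ... | no ¬mv with branching v ¬mv
    ...   | _ , _ , w₁≢w₂ , x₁ , x₂ = pathThrough w₁≢w₂ x₁ x₂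

-- Recolouring a vertex

swap₂ : Fin 2 → Fin 2
swap₂ zero = suc zero
swap₂ (suc zero) = zero

swap₂-≢⇔≡ : ∀ {a b} → swap₂ a ≢ b ⇔ a ≡ b
swap₂-≢⇔≡ {zero} {zero} = mk⇔ (λ _ → refl) (λ _ ())
swap₂-≢⇔≡ {zero} {suc zero} = mk⇔ (λ ne → ⊥-elim (ne refl)) (λ ())
swap₂-≢⇔≡ {suc zero} {zero} = mk⇔ (λ ne → ⊥-elim (ne refl)) (λ ())
swap₂-≢⇔≡ {suc zero} {suc zero} = mk⇔ (λ _ → refl) (λ _ ())

module _ {m : ℕ} (v : Fin m) where

  Incident : Edge m → Set
  Incident e = proj₁ e ≡ v ⊎ proj₂ e ≡ v

  incident? : ∀ e → Dec (Incident e)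
  incident? e = (proj₁ e ≟ v) ⊎-dec (proj₂ e ≟ v)

  recolour : (Fin m → Fin 2) → Fin m → Fin 2
  recolour g u with u ≟ v
  ... | yes _ = swap₂ (g u)
  ... | no _ = g u

  recolour-at : ∀ g → recolour g v ≡ swap₂ (g v)
  recolour-at g with v ≟ v
  ... | yes _ = refl
  ... | no v≢v = ⊥-elim (v≢v refl)

  recolour-off : ∀ g {u} → u ≢ v → recolour g u ≡ g u
  recolour-off g {u} u≢v with u ≟ v
  ... | yes u≡v = ⊥-elim (u≢v u≡v)
  ... | no _ = refl

  recolour-incident : ∀ g {p q} → p ≢ q → Incident (p , q) → (recolour g p ≢ recolour g q) ⇔ (g p ≡ g q)
  recolour-incident g v≢q (inj₁ refl)
    rewrite recolour-at g | recolour-off g (λ q≡v → v≢q (sym q≡v)) = swap₂-≢⇔≡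
  recolour-incident g p≢v (inj₂ refl)
    rewrite recolour-at g | recolour-off g p≢v =
    mk⇔ (λ ne → sym (Equivalence.to swap₂-≢⇔≡ (λ eq → ne (sym eq))))
        (λ eq ne → Equivalence.from swap₂-≢⇔≡ (sym eq) (sym ne))

  recolour-apart : ∀ g {p q} → ¬ Incident (p , q) → (recolour g p ≡ recolour g q) ⇔ (g p ≡ g q)
  recolour-apart g ¬inc
    rewrite recolour-off g (λ p≡v → ¬inc (inj₁ p≡v)) | recolour-off g (λ q≡v → ¬inc (inj₂ q≡v)) =
    mk⇔ (λ eq → eq) (λ eq → eq)

-- Parsimony on phylogenetic trees

module _ {n : ℕ} (T : PhyloTree n) where

  edge-adj : ∀ {e} → e ∈ edges T → Adj (edges T) (proj₁ e) (proj₂ e)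
  edge-adj e∈ = lose e∈ (inj₁ (refl , refl))

  changes-mono : ∀ {j k} {h : Fin (m T) → Fin j} {g : Fin (m T) → Fin k} →
                 (∀ {u v} → Adj (edges T) u v → g u ≡ g v → h u ≡ h v) → changes T h ≤ changes T g
  changes-mono {h = h} {g} g≡⇒h≡ =
    length-filter-mono (∁? (monochromatic? h)) (∁? (monochromatic? g)) (edges T)
      (λ e∈ hu≢hv gu≡gv → hu≢hv (g≡⇒h≡ (edge-adj e∈) gu≡gv))

  forest+changes : ∀ {j} (h : Fin (m T) → Fin j) → length (forestEdges T h) + changes T h ≡ length (edges T)
  forest+changes h = length-filter-∁ (monochromatic? h) (edges T)

  components≤changes+1 : ∀ {j} (h : Fin (m T) → Fin j) {L} → Separated (forestEdges T h) L →
                         length L ≤ changes T h + 1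
  components≤changes+1 h = length-separated (mutationEdges T h) (λ a b → reach-mono split (connected T a b))
    where
      split : ∀ {a b} → Adj (edges T) a b → Reach (mutationEdges T h ++ forestEdges T h) a b
      split {a} {b} x with h a ≟ h b
      ... | yes ha≡hb = adj⇒reach (++⁺ʳ (mutationEdges T h) (adj-monochromatic⁺ h x ha≡hb))
      ... | no ha≢hb with find x
      ...   | e , e∈ , s = adj⇒reach (++⁺ˡ (lose (∈-filter⁺ (∁? (monochromatic? h)) e∈ (colour s)) s))
        where
          colour : SameEdge e (a , b) → ¬ Monochromatic h e
          colour (inj₁ (refl , refl)) = ha≢hb
          colour (inj₂ (refl , refl)) = λ eq → ha≢hb (sym eq)

  changes<colours : ∀ {j k} (h : Fin (m T) → Fin j) (col : Fin (m T) → Fin k) →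
                    (∀ {a b} → col a ≡ col b → Reach (forestEdges T h) a b) → changes T h < k
  changes<colours h col col≡⇒reach with separatedRepresentatives (forestEdges T h)
  ... | L , sL , m≤F+L = ≤-trans (+-cancelˡ-≤ (length (forestEdges T h)) _ _ F+changes<F+L) L≤k
    where
      F+changes<F+L : length (forestEdges T h) + suc (changes T h) ≤ length (forestEdges T h) + length L
      F+changes<F+L = begin
        length (forestEdges T h) + suc (changes T h)  ≡⟨ +-suc (length (forestEdges T h)) (changes T h) ⟩
        suc (length (forestEdges T h) + changes T h)  ≡⟨ cong suc (forest+changes h) ⟩
        suc (length (edges T))                        ≡⟨ +-comm 1 (length (edges T)) ⟩
        length (edges T) + 1                          ≡⟨ edgeCount T ⟩
        m T                                           ≤⟨ m≤F+L ⟩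
        length (forestEdges T h) + length L           ∎
        where open ≤-Reasoning
      L≤k : length L ≤ _
      L≤k = subst (_≤ _) (length-map col L)
              (length-unique-Fin (AllPairs.map⁺ (AllPairs.map (λ a≁b ca≡cb → a≁b (col≡⇒reach ca≡cb)) sL)))

  -- Otherwise recolouring v would remove at least two mutations and create at most one.
  optimal⇒monochromaticIncident : ∀ {f : Fin n → Fin 2} {g} → IsOptimal T f g →
                                  ∀ v → (∀ x → leaf T x ≢ v) →
                                  2 ≤ length (filter (incident? v ∩? monochromatic? g) (edges T))
  optimal⇒monochromaticIncident {g = g} (g-ext , g-opt) v internal = ≰⇒> A≰1
    where
      E = edges T
      count = λ {P : Edge (m T) → Set} (P? : Decidable P) → length (filter P? E)
      g' = recolour v g
      inc = incident? v
      mono = monochromatic? g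
      mono' = monochromatic? g'
      A = count (inc ∩? mono)
      B = count (inc ∩? ∁? mono)
      R = count (∁? mono ∩? ∁? inc)
      loopless : ∀ {e} → e ∈ E → proj₁ e ≢ proj₂ e
      loopless = All.lookup (noLoops T)
      degree : A + B ≡ 3
      degree = trans (sym (length-filter-split inc mono E)) (internalDeg T v internal)
      changes-g : changes T g ≡ B + R
      changes-g = trans (length-filter-split (∁? mono) inc E)
        (cong (_+ R) (length-filter-cong (∁? mono ∩? inc) (inc ∩? ∁? mono) E
          (λ _ (p , q) → q , p) (λ _ (p , q) → q , p)))
      changes-g' : changes T g' ≡ A + R
      changes-g' = trans (length-filter-split (∁? mono') inc E) (cong₂ _+_
        (length-filter-cong (∁? mono' ∩? inc) (inc ∩? mono) E
          (λ e∈ (ne , i) → i , Equivalence.to (recolour-incident v g (loopless e∈) i) ne)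
          (λ e∈ (i , eq) → Equivalence.from (recolour-incident v g (loopless e∈) i) eq , i))
        (length-filter-cong (∁? mono' ∩? ∁? inc) (∁? mono ∩? ∁? inc) E
          (λ _ (ne , ¬i) → (λ eq → ne (Equivalence.from (recolour-apart v g ¬i) eq)) , ¬i)
          (λ _ (ne , ¬i) → (λ eq → ne (Equivalence.to (recolour-apart v g ¬i) eq)) , ¬i)))
      g'-ext : IsExtension T _ g'
      g'-ext x = trans (recolour-off v g (internal x)) (g-ext x)
      B≤A : B ≤ A
      B≤A = +-cancelʳ-≤ R B A (subst₂ _≤_ changes-g changes-g' (g-opt g' g'-ext))
      A≰1 : ¬ A ≤ 1
      A≰1 A≤1 = n≮n 2 (≤-trans (≤-reflexive (sym degree)) (+-mono-≤ A≤1 (≤-trans B≤A A≤1)))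

  optimal⇒forestBranching : ∀ {f : Fin n → Fin 2} {g} → IsOptimal T f g →
                            ∀ v → ¬ (∃ λ x → leaf T x ≡ v) → ∃ λ w₁ → ∃ λ w₂ → w₁ ≢ w₂ ×
                            Adj (forestEdges T g) v w₁ × Adj (forestEdges T g) v w₂
  optimal⇒forestBranching {g = g} g-opt v ¬leaf
    with filter-pair (incident? v ∩? monochromatic? g) (noMulti T)
           (optimal⇒monochromaticIncident g-opt v (λ x leaf≡v → ¬leaf (x , leaf≡v)))
  ... | e₁ , e₂ , e₁∈ , e₂∈ , (inc₁ , mono₁) , (inc₂ , mono₂) , e₁≉e₂
    with neighbour e₁∈ inc₁ mono₁ | neighbour e₂∈ inc₂ mono₂
    where
      neighbour : ∀ {e} → e ∈ edges T → Incident v e → Monochromatic g e →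
                  ∃ λ w → Adj (forestEdges T g) v w × SameEdge e (v , w)
      neighbour e∈ (inj₁ refl) mono = _ , adj-monochromatic⁺ g (edge-adj e∈) mono , inj₁ (refl , refl)
      neighbour e∈ (inj₂ refl) mono = _ , adj-sym (adj-monochromatic⁺ g (edge-adj e∈) mono) , sameEdge-flip
  ...   | w₁ , x₁ , s₁ | w₂ , x₂ , s₂ =
          w₁ , w₂ , (λ { refl → e₁≉e₂ (sameEdge-trans s₁ (sameEdge-sym s₂)) }) , x₁ , x₂

module _ {n : ℕ} (T : PhyloTree n) {k : ℕ} {fc : Fin n → Fin k} where

  reach⇒sameBlock : ∀ {h : Fin (m T) → Fin k} → IsExtension T fc h → ∀ {x y} →
                    Reach (forestEdges T h) (leaf T x) (leaf T y) → fc x ≡ fc y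
  reach⇒sameBlock {h = h} h-ext {x} {y} r =
    trans (sym (h-ext x)) (trans (reach-monochromatic⇒≡ h {edges T} r) (h-ext y))

  -- One leaf from every block, plus a second leaf of the split block, lie in distinct components.
  splitBlock⇒k≤changes : Surjective fc → ∀ {h} → IsExtension T fc h → ∀ {x y} → fc x ≡ fc y →
                          ¬ Reach (forestEdges T h) (leaf T x) (leaf T y) → k ≤ changes T h
  splitBlock⇒k≤changes fc-surj {h} h-ext {x} {y} x~y x≁y =
    +-cancelʳ-≤ 1 k (changes T h)
      (subst (_≤ changes T h + 1) (trans (cong suc (length-tabulate leafOf)) (+-comm 1 k))
        (components≤changes+1 T h (second-apart ∷ AllPairs.tabulate⁺ representatives-apart)))
    where
      F = forestEdges T h
      rep : Fin k → Fin n
      rep c = proj₁ (fc-surj c)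
      leafOf : Fin k → Fin (m T)
      leafOf c = leaf T (rep c)
      representatives-apart : ∀ {c c'} → c ≢ c' → ¬ Reach F (leafOf c) (leafOf c')
      representatives-apart {c} {c'} c≢c' r =
        c≢c' (trans (sym (proj₂ (fc-surj c))) (trans (reach⇒sameBlock h-ext r) (proj₂ (fc-surj c'))))
      second : ∃ λ w → fc w ≡ fc x × ¬ Reach F (leafOf (fc x)) (leaf T w)
      second with reach? F (leafOf (fc x)) (leaf T x)
      ... | no r≁x = x , refl , r≁x
      ... | yes r~x = y , sym x~y , λ r~y → x≁y (reach-trans (reach-sym r~x) r~y)
      second-apart : All (λ b → ¬ Reach F (leaf T (proj₁ second)) b) (tabulate leafOf)
      second-apart = tabulate⁺ apart
        where
          w = proj₁ second
          apart : ∀ c → ¬ Reach F (leaf T w) (leafOf c)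
          apart c r with c ≟ fc x
          ... | yes refl = proj₂ (proj₂ second) (reach-sym r)
          ... | no c≢fcx =
                c≢fcx (trans (sym (proj₂ (fc-surj c))) (trans (sym (reach⇒sameBlock h-ext r)) (proj₁ (proj₂ second))))

  constantOnSpanningSubtree : Surjective fc → ∀ {h} → IsExtension T fc h → changes T h < k →
                              ∀ {c v} → InSpanningSubtree T fc c v → h v ≡ c
  constantOnSpanningSubtree fc-surj {h} h-ext changes<k (x , y , x∈c , y∈c , _ , (walk , unique) , v∈p)
    with reach? (forestEdges T h) (leaf T x) (leaf T y)
  ... | yes x~y = trans (sym (reach-monochromatic⇒≡ h {edges T} x~v)) (trans (h-ext x) x∈c)
    where x~v = Tree.path-monochromatic (edges T) (connected T) (edgeCount T) h walk unique x~y v∈p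
  ... | no x≁y =
        ⊥-elim (n≮n k (≤-<-trans (splitBlock⇒k≤changes fc-surj h-ext (trans x∈c (sym y∈c)) x≁y) changes<k))

-- The character of the forest of an optimal extension

module ForestCharacter {n : ℕ} (T : PhyloTree n) {f : Fin n → Fin 2} {g : Fin (m T) → Fin 2}
  (g-opt : IsOptimal T f g)
  (reachesLeaf : ∀ v → ∃ λ x → Reach (forestEdges T g) v (leaf T x))
  {k : ℕ} (fc : Fin n → Fin k) (fc-surj : Surjective fc)
  (fc-blocks : ∀ x y → (fc x ≡ fc y) ⇔ Reach (forestEdges T g) (leaf T x) (leaf T y)) where

  F = forestEdges T g

  componentColour : Fin (m T) → Fin k
  componentColour v = fc (proj₁ (reachesLeaf v))

  componentColour-reach : ∀ {v x} → Reach F v (leaf T x) → componentColour v ≡ fc x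
  componentColour-reach {v} r = Equivalence.from (fc-blocks _ _) (reach-trans (reach-sym (proj₂ (reachesLeaf v))) r)

  componentColour-extension : IsExtension T fc componentColour
  componentColour-extension x = componentColour-reach here

  componentColour≡⇒reach : ∀ {a b} → componentColour a ≡ componentColour b → Reach F a b
  componentColour≡⇒reach {a} {b} eq =
    reach-trans (proj₂ (reachesLeaf a))
      (reach-trans (Equivalence.to (fc-blocks _ _) eq) (reach-sym (proj₂ (reachesLeaf b))))

  changes-componentColour : changes T componentColour ≤ changes T g
  changes-componentColour = changes-mono T λ {_} {b} x ga≡gb →
    componentColour-reach (step (adj-monochromatic⁺ g x ga≡gb) (proj₂ (reachesLeaf b)))

  changes<k : changes T g < k
  changes<k = changes<colours T g componentColour componentColour≡⇒reach

  -- Reading off the f-state of each block turns an extension of fc into one of f.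
  componentColour-optimal : IsOptimal T fc componentColour
  componentColour-optimal = componentColour-extension , λ h h-ext →
    ≤-trans changes-componentColour
      (≤-trans (proj₂ g-opt (blockState ∘ h) (λ x → trans (cong blockState (h-ext x)) (blockState-fc x)))
        (changes-mono T (λ _ → cong blockState)))
    where
      blockState : Fin k → Fin 2
      blockState c = f (proj₁ (fc-surj c))
      blockState-fc : ∀ x → blockState (fc x) ≡ f x
      blockState-fc x = trans (sym (proj₁ g-opt _))
        (trans (reach-monochromatic⇒≡ g {edges T} (Equivalence.to (fc-blocks _ _) (proj₂ (fc-surj (fc x)))))
               (proj₁ g-opt x))

  forest⊆tree : ∀ {a b} → Adj F a b → Adj (edges T) a b
  forest⊆tree = proj₁ ∘ adj-monochromatic⁻ g {edges T}

  spanningSubtreesCover : ∀ v → ∃ λ c → InSpanningSubtree T fc c v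
  spanningSubtreesCover v with Leaves.onMarkedPath v
    where
      module Leaves = Tree.Leaves (edges T) (connected T) (edgeCount T) F forest⊆tree
                        (λ u → any? (λ x → leaf T x ≟ u)) (optimal⇒forestBranching T g-opt)
  ... | _ , _ , (x , refl) , (y , refl) , p , (walk , unique) , v∈p =
        fc x , x , y , refl , Equivalence.from (fc-blocks y x) (reach-sym (walk⇒reach walk)) ,
        p , (walk-mono forest⊆tree walk , unique) , v∈p

  optimal⇒constantOnSpanningSubtree : ∀ {h} → IsOptimal T fc h →
                                      ∀ {c v} → InSpanningSubtree T fc c v → h v ≡ c
  optimal⇒constantOnSpanningSubtree {h} (h-ext , h-opt) =
    constantOnSpanningSubtree T fc-surj h-ext
      (≤-<-trans (≤-trans (h-opt componentColour componentColour-extension) changes-componentColour) changes<k)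

  optimal⇒componentColour : ∀ {h} → IsOptimal T fc h → ∀ v → h v ≡ componentColour v
  optimal⇒componentColour h-opt v =
    trans (optimal⇒constantOnSpanningSubtree h-opt v∈c)
          (sym (optimal⇒constantOnSpanningSubtree componentColour-optimal v∈c))
    where v∈c = proj₂ (spanningSubtreesCover v)

mainTheorem17 : ∀ {n} (T T' : PhyloTree n) (f₂ : Character n 2) →
  AttainsD2MP T T' f₂ →
  (T* : PhyloTree n) → T* ≡ T ⊎ T* ≡ T' →
  (g₂ : Fin (m T*) → Fin 2) → IsOptimal T* (proj₁ f₂) g₂ →
  (∀ v → ∃ λ x → ∃ λ y → x ≢ y ×
      Reach (forestEdges T* g₂) v (leaf T* x) ×
      Reach (forestEdges T* g₂) v (leaf T* y)) →
  (k : ℕ) (fc : Fin n → Fin k) → Surjective fc →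
  (∀ x y → (fc x ≡ fc y) ⇔ Reach (forestEdges T* g₂) (leaf T* x) (leaf T* y)) →
  Σ (Fin (m T*) → Fin k) λ h →
    IsOptimal T* fc h ×
    (∀ h' → IsOptimal T* fc h' → ∀ v → h' v ≡ h v) ×
    IsNaturalCoveringExtension T* fc h
mainTheorem17 _ _ _ _ T* _ g₂ g₂-opt twoTaxa k fc fc-surj fc-blocks =
  componentColour , componentColour-optimal , (λ h h-opt → optimal⇒componentColour h-opt) ,
  spanningSubtreesCover , (λ v c → optimal⇒constantOnSpanningSubtree componentColour-optimal)
  where
    reachesLeaf : ∀ v → ∃ λ x → Reach (forestEdges T* g₂) v (leaf T* x)
    reachesLeaf v = let (x , _ , _ , v⇝x , _) = twoTaxa v in x , v⇝x
    open ForestCharacter T* g₂-opt reachesLeaf fc fc-surj fc-blocks
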